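{- Let $K_n$ be the directed graph on $[n]$ with edge set $\{(i,j):1\le i<j\le n\}$ and let $H\subseteq K_n$ be a subgraph. Then $Q_H$ is a face of $\tilde Q_{K_n}$ if and only if there are integers $0=n_0<n_1<\dots<n_\ell<n_{\ell+1}=n$ and, for each $k=1,\dots,\ell+1$, disjoint subsets $L_k,R_k\subseteq[n_{k-1}+1,n_k]$ such that $H=(K_{[1,n_1]})_{L_1,R_1}\sqcup(K_{[n_1+1,n_2]})_{L_2,R_2}\sqcup\dots\sqcup(K_{[n_\ell+1,n]})_{L_{\ell+1},R_{\ell+1}}$, i.e. $E(H)=\bigcup_k\{(a,b): a\in L_k,\ b\in R_k,\ a<b\}$.
   Context: $Q_H=\mathrm{conv}\{\mathbf e_i-\mathbf e_j:(i,j)\in E(H)\}$ and $\tilde Q_G=\mathrm{conv}\{\mathbf 0,\mathbf e_i-\mathbf e_j:(i,j)\in E(G)\}$ in $\mathbb R^n$. A subgraph has the same vertex set and a subset of edges. $[a,b]=\{a,\dots,b\}$; $K_{[a,b]}$ is the complete graph on $[a,b]$ with edges $(i,j)$, $i<j$; for disjoint $L,R\subseteq[a,b]$, $(K_{[a,b]})_{L,R}$ is the graph on $[a,b]$ with edge set $\{(i,j)\in E(K_{[a,b]}):i\in L,j\in R\}$.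
   Formalization: The polytopes $Q_H$ and $\tilde Q_{K_n}$ consist of points of ℚ^n rather than $\mathbb R^n$, with rational convex weights, and faces are cut out by rational supporting hyperplanes. -}

module Defs where

open import Data.Nat as ℕ using (ℕ; zero; suc)
open import Data.Fin using (Fin; zero; suc; toℕ; inject₁; fromℕ; _<_; _≟_)
open import Data.Fin.Subset using (Subset; _∈_)
open import Data.Rational using (ℚ; 0ℚ; 1ℚ; _+_; _-_; _*_; _≤_)
open import Data.Product using (Σ; ∃; ∃-syntax; _×_; _,_)
open import Data.Empty using (⊥)
open import Relation.Nullary.Decidable using (⌊_⌋)
open import Relation.Binary.PropositionalEquality using (_≡_)
open import Data.Bool using (if_then_else_)
open import Function.Bundles using (_⇔_)

-- Vertex i ∈ [n] (1-based in the paper) is represented by i-1 : Fin n.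

Point : ℕ → Set
Point n = Fin n → ℚ

∑ : ∀ {m} → (Fin m → ℚ) → ℚ
∑ {zero}  f = 0ℚ
∑ {suc m} f = f zero + ∑ (λ k → f (suc k))

_·_ : ∀ {n} → Point n → Point n → ℚ
c · x = ∑ (λ t → c t * x t)

𝐞 : ∀ {n} → Fin n → Point n
𝐞 i t = if ⌊ i ≟ t ⌋ then 1ℚ else 0ℚ

𝟎 : ∀ {n} → Point n
𝟎 t = 0ℚ

Graph : ℕ → Set₁
Graph n = Fin n → Fin n → Set

SubgraphOfK : ∀ {n} → Graph n → Set
SubgraphOfK {n} H = ∀ (i j : Fin n) → H i j → i < j

Conv : ∀ {n} → (Point n → Set) → Point n → Set
Conv {n} S x =
  ∃[ m ] Σ (Fin m → Point n) λ p → Σ (Fin m → ℚ) λ w →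
    (∀ k → S (p k)) × (∀ k → 0ℚ ≤ w k) × (∑ w ≡ 1ℚ) ×
    (∀ t → x t ≡ ∑ (λ k → w k * p k t))

EdgeVecs : ∀ {n} → Graph n → Point n → Set
EdgeVecs {n} H x = ∃[ i ] ∃[ j ] (H i j × (∀ t → x t ≡ 𝐞 i t - 𝐞 j t))

Q : ∀ {n} → Graph n → Point n → Set
Q H = Conv (EdgeVecs H)

Q̃ : ∀ {n} → Graph n → Point n → Set
Q̃ {n} G = Conv (λ x → (∀ t → x t ≡ 0ℚ) Data.Sum.⊎ EdgeVecs G x)
  where import Data.Sum

K : (n : ℕ) → Graph n
K n i j = i < j

-- F is a face of P: there is a valid inequality c·x ≤ b for P with
-- F = P ∩ {c·x = b}  (the empty set is a face, via b larger than the max)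
IsFace : ∀ {n} → (Point n → Set) → (Point n → Set) → Set
IsFace {n} F P =
  Σ (Point n) λ c → Σ ℚ λ b →
    (∀ x → P x → c · x ≤ b) × (∀ x → F x ⇔ (P x × (c · x ≡ b)))

-- the block decomposition on the right-hand side:
-- 0 = n_0 < n_1 < … < n_ℓ < n_{ℓ+1} = n, disjoint L_k, R_k ⊆ [n_{k-1}+1, n_k]
-- (k = 1..ℓ+1 is represented by k' : Fin (suc ℓ), n_{k-1} = ns (inject₁ k'),
-- n_k = ns (suc k')), and E(H) = ⋃_k {(a,b) : a ∈ L_k, b ∈ R_k, a < b}.
BlockDecomposition : ∀ {n} → Graph n → Set
BlockDecomposition {n} H =
  ∃[ ℓ ] Σ (Fin (suc (suc ℓ)) → ℕ) λ ns →
    (ns zero ≡ 0) × (ns (fromℕ (suc ℓ)) ≡ n) ×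
    (∀ (k : Fin (suc ℓ)) → ns (inject₁ k) ℕ.< ns (suc k)) ×
    Σ (Fin (suc ℓ) → Subset n) λ L → Σ (Fin (suc ℓ) → Subset n) λ R →
      (∀ k a → a ∈ L k → a ∈ R k → ⊥) ×
      (∀ k a → a ∈ L k → (ns (inject₁ k) ℕ.≤ toℕ a) × (toℕ a ℕ.< ns (suc k))) ×
      (∀ k a → a ∈ R k → (ns (inject₁ k) ℕ.≤ toℕ a) × (toℕ a ℕ.< ns (suc k))) ×
      (∀ a b → H a b ⇔ (∃[ k ] (a ∈ L k × b ∈ R k × a < b)))

{-# OPTIONS --safe #-}
-- A face of Q̃_{K_n} equal to Q_H is cut out by a functional c with c_i - c_j ≤ β for all i < j and
-- equality exactly on the edges of H: β > 0 because the origin lies in Q̃_{K_n} but not in Q_H, and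
-- an edge vector e_i - e_j in Q_H is an edge of H by extremality; conversely any such c cuts out Q_H.
-- Read c as a potential on [n]. A path a → v → b would give c_a - c_b = 2β > β, so no vertex is both
-- a tail and a head, and overlapping edges a → y, x → z (x < y, a < z) give c_a - c_z ≥ 2β - β, so
-- a → z is an edge. Cutting [n] at every point spanned by no edge therefore yields blocks in which
-- each tail a and head b with a < b form an edge. Conversely, a block decomposition is realised by
-- the potential 3 · (index of the block) + (2 on L, 1 off L ∪ R, 0 on R) with β = 2.
module Submission where

open import Defs
open import Data.Nat using (ℕ; _≤_)
open import Function.Bundles using (_⇔_)

open import Data.Bool.Base using (true)
open import Data.Empty using (⊥; ⊥-elim)
open import Data.Fin.Base as Fin using (Fin; zero; suc; toℕ; inject₁; fromℕ)
import Data.Fin.Induction as Fin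
import Data.Fin.Properties as Fin
open import Data.Fin.Subset using (Subset; _∈_)
open import Data.Fin.Subset.Properties using (_∈?_)
open import Data.Nat.Base as ℕ using (zero; suc; _<_; z≤n; s≤s)
import Data.Nat.Properties as ℕ
open import Data.Product as Σ using (Σ; ∃; ∃-syntax; _×_; _,_; proj₁; proj₂)
open import Data.Rational.Base as ℚ using (ℚ; 0ℚ; 1ℚ; _+_; _-_; _*_; -_)
import Data.Rational.Properties as ℚ
open import Algebra.Properties.Group ℚ.+-0-group using () renaming (x∙y⁻¹≈ε⇒x≈y to p-q≡0⇒p≡q)
open import Data.Rational.Solver using (module +-*-Solver)
open import Data.Sum as Sum using (_⊎_; inj₁; inj₂; [_,_]′)
open import Data.Vec.Base using (tabulate)
import Data.Vec.Properties as Vec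
open import Function.Base using (_∘_; id)
open import Function.Bundles using (mk⇔; Equivalence)
open import Function.Construct.Composition using (_⇔-∘_)
open import Function.Construct.Symmetry using (⇔-sym)
open import Induction.WellFounded using (Acc; acc)
open import Relation.Binary.Definitions using (tri<; tri≈; tri>)
open import Relation.Binary.PropositionalEquality
open import Relation.Nullary using (¬_; Dec; yes; no; does)
open import Relation.Nullary.Decidable as Dec using (dec-true; _×-dec_; ¬?)

open +-*-Solver using (solve; _:+_; _:*_; _:-_; :-_; _:=_)
open Equivalence using (to; from)

0<1 : 0ℚ ℚ.< 1ℚ
0<1 = ℚ.positive⁻¹ 1ℚ

[p-q]+q≡p : ∀ p q → (p - q) + q ≡ p
[p-q]+q≡p = solve 2 (λ p q → (p :- q) :+ q := p) refl

[p+q]-q≡p : ∀ p q → (p + q) - q ≡ p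
[p+q]-q≡p = solve 2 (λ p q → (p :+ q) :- q := p) refl

p-q≡r⇔p≡r+q : ∀ {p q r} → p - q ≡ r ⇔ p ≡ r + q
p-q≡r⇔p≡r+q {p} {q} {r} = mk⇔
  (λ p-q≡r → trans (sym ([p-q]+q≡p p q)) (cong (_+ q) p-q≡r))
  (λ p≡r+q → trans (cong (_- q) p≡r+q) ([p+q]-q≡p r q))

p≤r+q⇒p-q≤r : ∀ {p q r} → p ℚ.≤ r + q → p - q ℚ.≤ r
p≤r+q⇒p-q≤r {p} {q} {r} p≤r+q = ℚ.≤-trans (ℚ.+-monoˡ-≤ (- q) p≤r+q) (ℚ.≤-reflexive ([p+q]-q≡p r q))

p≤q⇒0≤q-p : ∀ {p q} → p ℚ.≤ q → 0ℚ ℚ.≤ q - p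
p≤q⇒0≤q-p {p} p≤q = ℚ.≤-trans (ℚ.≤-reflexive (sym (ℚ.+-inverseʳ p))) (ℚ.+-monoˡ-≤ (- p) p≤q)

0≤q-p⇒p≤q : ∀ {p q} → 0ℚ ℚ.≤ q - p → p ℚ.≤ q
0≤q-p⇒p≤q {p} {q} 0≤q-p = ℚ.≤-trans (ℚ.≤-reflexive (sym (ℚ.+-identityˡ p)))
  (ℚ.≤-trans (ℚ.+-monoˡ-≤ p 0≤q-p) (ℚ.≤-reflexive ([p-q]+q≡p q p)))

0≤p*q : ∀ {p q} → 0ℚ ℚ.≤ p → 0ℚ ℚ.≤ q → 0ℚ ℚ.≤ p * q
0≤p*q {p} {q} 0≤p 0≤q =
  ℚ.nonNegative⁻¹ _ {{ℚ.nonNeg*nonNeg⇒nonNeg p {{ℚ.nonNegative 0≤p}} q {{ℚ.nonNegative 0≤q}}}}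

p*q≡0⇒p≡0∨q≡0 : ∀ p q → p * q ≡ 0ℚ → p ≡ 0ℚ ⊎ q ≡ 0ℚ
p*q≡0⇒p≡0∨q≡0 p q pq≡0 with p ℚ.≟ 0ℚ
... | yes p≡0 = inj₁ p≡0
... | no  p≢0 = inj₂ (begin
  q                 ≡⟨ sym (ℚ.*-identityˡ q) ⟩
  1ℚ * q            ≡⟨ cong (_* q) (sym (ℚ.*-inverseˡ p)) ⟩
  ℚ.1/ p * p * q    ≡⟨ ℚ.*-assoc (ℚ.1/ p) p q ⟩
  ℚ.1/ p * (p * q)  ≡⟨ cong (ℚ.1/ p *_) pq≡0 ⟩
  ℚ.1/ p * 0ℚ       ≡⟨ ℚ.*-zeroʳ (ℚ.1/ p) ⟩
  0ℚ                ∎)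
  where
  open ≡-Reasoning
  instance
    p-nonZero : ℚ.NonZero p
    p-nonZero = ℚ.≢-nonZero p≢0

p+q≡2⇒p≡1∧q≡1 : ∀ {p q} → p ℚ.≤ 1ℚ → q ℚ.≤ 1ℚ → p + q ≡ 1ℚ + 1ℚ → p ≡ 1ℚ × q ≡ 1ℚ
p+q≡2⇒p≡1∧q≡1 p≤1 q≤1 p+q≡2 =
  ℚ.≤-antisym p≤1 (ℚ.≮⇒≥ (λ p<1 → ℚ.<-irrefl p+q≡2 (ℚ.+-mono-<-≤ p<1 q≤1))) ,
  ℚ.≤-antisym q≤1 (ℚ.≮⇒≥ (λ q<1 → ℚ.<-irrefl p+q≡2 (ℚ.+-mono-≤-< p≤1 q<1)))

ι : ℕ → ℚ
ι zero    = 0ℚ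
ι (suc n) = 1ℚ + ι n

ι-homo-+ : ∀ m n → ι (m ℕ.+ n) ≡ ι m + ι n
ι-homo-+ zero    n = sym (ℚ.+-identityˡ (ι n))
ι-homo-+ (suc m) n = trans (cong (1ℚ +_) (ι-homo-+ m n)) (sym (ℚ.+-assoc 1ℚ (ι m) (ι n)))

ι-mono-≤ : ∀ {m n} → m ≤ n → ι m ℚ.≤ ι n
ι-mono-≤ {n = zero}  z≤n       = ℚ.≤-refl
ι-mono-≤ {n = suc n} z≤n       = ℚ.+-mono-≤ (ℚ.<⇒≤ 0<1) (ι-mono-≤ {n = n} z≤n)
ι-mono-≤             (s≤s m≤n) = ℚ.+-monoʳ-≤ 1ℚ (ι-mono-≤ m≤n)

ι-mono-< : ∀ {m n} → m < n → ι m ℚ.< ι n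
ι-mono-< {m} m<n = ℚ.<-≤-trans (ℚ.<-respˡ-≡ (ℚ.+-identityˡ (ι m)) (ℚ.+-monoˡ-< (ι m) 0<1)) (ι-mono-≤ m<n)

ι-cancel-≤ : ∀ {m n} → ι m ℚ.≤ ι n → m ≤ n
ι-cancel-≤ ιm≤ιn = ℕ.≮⇒≥ (λ n<m → ℚ.<-irrefl refl (ℚ.<-≤-trans (ι-mono-< n<m) ιm≤ιn))

ι-injective : ∀ {m n} → ι m ≡ ι n → m ≡ n
ι-injective ιm≡ιn = ℕ.≤-antisym (ι-cancel-≤ (ℚ.≤-reflexive ιm≡ιn)) (ι-cancel-≤ (ℚ.≤-reflexive (sym ιm≡ιn)))

∑-cong : ∀ {m} {f g : Fin m → ℚ} → (∀ k → f k ≡ g k) → ∑ f ≡ ∑ g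
∑-cong {zero}  f≗g = refl
∑-cong {suc m} f≗g = cong₂ _+_ (f≗g zero) (∑-cong (f≗g ∘ suc))

∑-zero : ∀ m → ∑ {m} (λ _ → 0ℚ) ≡ 0ℚ
∑-zero zero    = refl
∑-zero (suc m) = trans (ℚ.+-identityˡ _) (∑-zero m)

∑-distrib-+ : ∀ {m} (f g : Fin m → ℚ) → ∑ (λ k → f k + g k) ≡ ∑ f + ∑ g
∑-distrib-+ {zero}  f g = refl
∑-distrib-+ {suc m} f g = trans (cong (f zero + g zero +_) (∑-distrib-+ (f ∘ suc) (g ∘ suc)))
  (solve 4 (λ a b c d → (a :+ b) :+ (c :+ d) := (a :+ c) :+ (b :+ d)) refl (f zero) (g zero) _ _)

∑-neg : ∀ {m} (f : Fin m → ℚ) → ∑ (λ k → - f k) ≡ - ∑ f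
∑-neg {zero}  f = refl
∑-neg {suc m} f = trans (cong (- f zero +_) (∑-neg (f ∘ suc))) (sym (ℚ.neg-distrib-+ (f zero) _))

*-distribˡ-∑ : ∀ {m} r (f : Fin m → ℚ) → r * ∑ f ≡ ∑ (λ k → r * f k)
*-distribˡ-∑ {zero}  r f = ℚ.*-zeroʳ r
*-distribˡ-∑ {suc m} r f = trans (ℚ.*-distribˡ-+ r (f zero) _) (cong (r * f zero +_) (*-distribˡ-∑ r (f ∘ suc)))

∑-comm : ∀ {m l} (f : Fin m → Fin l → ℚ) → ∑ (λ i → ∑ (f i)) ≡ ∑ (λ j → ∑ (λ i → f i j))
∑-comm {zero}  {l} f = sym (∑-zero l)
∑-comm {suc m}     f = trans (cong (∑ (f zero) +_) (∑-comm (f ∘ suc))) (sym (∑-distrib-+ (f zero) _))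

∑-nonNeg : ∀ {m} {f : Fin m → ℚ} → (∀ k → 0ℚ ℚ.≤ f k) → 0ℚ ℚ.≤ ∑ f
∑-nonNeg {zero}  f≥0 = ℚ.≤-refl
∑-nonNeg {suc m} f≥0 = ℚ.+-mono-≤ (f≥0 zero) (∑-nonNeg (f≥0 ∘ suc))

term≤∑ : ∀ {m} {f : Fin m → ℚ} → (∀ k → 0ℚ ℚ.≤ f k) → ∀ k → f k ℚ.≤ ∑ f
term≤∑ {f = f} f≥0 zero = ℚ.≤-trans (ℚ.≤-reflexive (sym (ℚ.+-identityʳ (f zero))))
  (ℚ.+-monoʳ-≤ (f zero) (∑-nonNeg (f≥0 ∘ suc)))
term≤∑ {f = f} f≥0 (suc k) = ℚ.≤-trans (term≤∑ (f≥0 ∘ suc) k)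
  (ℚ.≤-trans (ℚ.≤-reflexive (sym (ℚ.+-identityˡ _))) (ℚ.+-monoˡ-≤ _ (f≥0 zero)))

∑-nonNeg≡0 : ∀ {m} {f : Fin m → ℚ} → (∀ k → 0ℚ ℚ.≤ f k) → ∑ f ≡ 0ℚ → ∀ k → f k ≡ 0ℚ
∑-nonNeg≡0 f≥0 ∑f≡0 k = ℚ.≤-antisym (ℚ.≤-trans (term≤∑ f≥0 k) (ℚ.≤-reflexive ∑f≡0)) (f≥0 k)

∑≢0⇒term≢0 : ∀ {m} (f : Fin m → ℚ) → ∑ f ≢ 0ℚ → ∃[ k ] f k ≢ 0ℚ
∑≢0⇒term≢0 {zero}  f ∑f≢0 = ⊥-elim (∑f≢0 refl)
∑≢0⇒term≢0 {suc m} f ∑f≢0 with f zero ℚ.≟ 0ℚ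
... | no f₀≢0 = zero , f₀≢0
... | yes f₀≡0 with ∑≢0⇒term≢0 (f ∘ suc) (λ ∑≡0 → ∑f≢0 (cong₂ _+_ f₀≡0 ∑≡0))
...   | k , fk≢0 = suc k , fk≢0

edge : ∀ {n} → Fin n → Fin n → Point n
edge i j t = 𝐞 i t - 𝐞 j t

·-cong : ∀ {n} (c : Point n) {x y : Point n} → (∀ t → x t ≡ y t) → c · x ≡ c · y
·-cong c x≗y = ∑-cong (λ t → cong (c t *_) (x≗y t))

·-𝟎 : ∀ {n} (c : Point n) → c · 𝟎 ≡ 0ℚ
·-𝟎 {n} c = trans (∑-cong (λ t → ℚ.*-zeroʳ (c t))) (∑-zero n)

𝐞-suc : ∀ {n} (i t : Fin n) → 𝐞 (suc i) (suc t) ≡ 𝐞 i t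
𝐞-suc i t with i Fin.≟ t
... | yes _ = refl
... | no _  = refl

·-𝐞 : ∀ {n} (c : Point n) (i : Fin n) → c · 𝐞 i ≡ c i
·-𝐞 {suc n} c zero = begin
  c zero * 1ℚ + ∑ (λ t → c (suc t) * 0ℚ)  ≡⟨ cong₂ _+_ (ℚ.*-identityʳ (c zero)) (·-𝟎 (c ∘ suc)) ⟩
  c zero + 0ℚ                             ≡⟨ ℚ.+-identityʳ (c zero) ⟩
  c zero                                  ∎
  where open ≡-Reasoning
·-𝐞 {suc n} c (suc i) = begin
  c zero * 0ℚ + ∑ (λ t → c (suc t) * 𝐞 (suc i) (suc t))
    ≡⟨ cong₂ _+_ (ℚ.*-zeroʳ (c zero)) (·-cong (c ∘ suc) (𝐞-suc i)) ⟩
  0ℚ + (c ∘ suc) · 𝐞 i  ≡⟨ ℚ.+-identityˡ _ ⟩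
  (c ∘ suc) · 𝐞 i       ≡⟨ ·-𝐞 (c ∘ suc) i ⟩
  c (suc i)             ∎
  where open ≡-Reasoning

·-edge : ∀ {n} (c : Point n) (i j : Fin n) → c · edge i j ≡ c i - c j
·-edge c i j = begin
  ∑ (λ t → c t * (𝐞 i t - 𝐞 j t))            ≡⟨ ∑-cong (λ t → trans (ℚ.*-distribˡ-+ (c t) _ _)
                                                  (cong (c t * 𝐞 i t +_) (sym (ℚ.neg-distribʳ-* (c t) _)))) ⟩
  ∑ (λ t → c t * 𝐞 i t + - (c t * 𝐞 j t))   ≡⟨ ∑-distrib-+ (λ t → c t * 𝐞 i t) _ ⟩
  c · 𝐞 i + ∑ (λ t → - (c t * 𝐞 j t))       ≡⟨ cong (c · 𝐞 i +_) (∑-neg (λ t → c t * 𝐞 j t)) ⟩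
  c · 𝐞 i - c · 𝐞 j                          ≡⟨ cong₂ _-_ (·-𝐞 c i) (·-𝐞 c j) ⟩
  c i - c j                                  ∎
  where open ≡-Reasoning

·-combination : ∀ {n m} (c x : Point n) (p : Fin m → Point n) (w : Fin m → ℚ) →
                (∀ t → x t ≡ ∑ (λ k → w k * p k t)) → c · x ≡ ∑ (λ k → w k * (c · p k))
·-combination c x p w x≡ = begin
  c · x                                        ≡⟨ ·-cong c x≡ ⟩
  ∑ (λ t → c t * ∑ (λ k → w k * p k t))        ≡⟨ ∑-cong (λ t → *-distribˡ-∑ (c t) (λ k → w k * p k t)) ⟩
  ∑ (λ t → ∑ (λ k → c t * (w k * p k t)))      ≡⟨ ∑-comm (λ t k → c t * (w k * p k t)) ⟩
  ∑ (λ k → ∑ (λ t → c t * (w k * p k t)))      ≡⟨ ∑-cong (λ k → ∑-cong (λ t → swap (c t) (w k) (p k t))) ⟩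
  ∑ (λ k → ∑ (λ t → w k * (c t * p k t)))      ≡⟨ ∑-cong (λ k → sym (*-distribˡ-∑ (w k) (λ t → c t * p k t))) ⟩
  ∑ (λ k → w k * (c · p k))                    ∎
  where
  open ≡-Reasoning
  swap : ∀ a b d → a * (b * d) ≡ b * (a * d)
  swap = solve 3 (λ a b d → a :* (b :* d) := b :* (a :* d)) refl

·-≗𝟎 : ∀ {n} (c : Point n) {y : Point n} → (∀ t → y t ≡ 0ℚ) → c · y ≡ 0ℚ
·-≗𝟎 c y≗𝟎 = trans (·-cong c y≗𝟎) (·-𝟎 c)

·-≗edge : ∀ {n} (c : Point n) {y : Point n} {i j : Fin n} → (∀ t → y t ≡ edge i j t) → c · y ≡ c i - c j
·-≗edge c {i = i} {j} y≗ = trans (·-cong c y≗) (·-edge c i j)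

𝐞-same : ∀ {n} {i a : Fin n} → i ≡ a → 𝐞 i a ≡ 1ℚ
𝐞-same {i = i} {a} i≡a with i Fin.≟ a
... | yes _   = refl
... | no i≢a = ⊥-elim (i≢a i≡a)

𝐞-other : ∀ {n} {i a : Fin n} → i ≢ a → 𝐞 i a ≡ 0ℚ
𝐞-other {i = i} {a} i≢a with i Fin.≟ a
... | yes i≡a = ⊥-elim (i≢a i≡a)
... | no _    = refl

𝐞-difference≤1 : ∀ {n} (i a b : Fin n) → 𝐞 i a - 𝐞 i b ℚ.≤ 1ℚ
𝐞-difference≤1 i a b with i Fin.≟ a | i Fin.≟ b
... | yes _ | yes _ = ℚ.<⇒≤ 0<1
... | yes _ | no _  = ℚ.≤-refl
... | no _  | yes _ = ℚ.<⇒≤ (ℚ.<-trans (ℚ.neg-antimono-< 0<1) 0<1)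
... | no _  | no _  = ℚ.<⇒≤ 0<1

𝐞-difference≡1 : ∀ {n} (i a b : Fin n) → 𝐞 i a - 𝐞 i b ≡ 1ℚ → i ≡ a
𝐞-difference≡1 i a b with i Fin.≟ a | i Fin.≟ b
... | yes i≡a | _     = λ _ → i≡a
... | no _    | yes _ = λ ()
... | no _    | no _  = λ ()

-- Convex hulls

Conv-mono : ∀ {n} {S T : Point n → Set} → (∀ y → S y → T y) → ∀ {x} → Conv S x → Conv T x
Conv-mono S⊆T (m , p , w , p∈S , rest) = m , p , w , (λ k → S⊆T (p k) (p∈S k)) , rest

Conv-singleton : ∀ {n} {S : Point n → Set} {y} → S y → Conv S y
Conv-singleton {y = y} y∈S = 1 , (λ _ → y) , (λ _ → 1ℚ) , (λ _ → y∈S) , (λ _ → ℚ.<⇒≤ 0<1) , refl ,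
  λ t → sym (trans (ℚ.+-identityʳ _) (ℚ.*-identityˡ (y t)))

Conv-nonempty : ∀ {n} {S : Point n → Set} {x} → Conv S x → ∃ S
Conv-nonempty (zero  , _ , _ , _   , _ , ∑w≡1 , _) = ⊥-elim (ℚ.1≢0 (sym ∑w≡1))
Conv-nonempty (suc m , p , _ , p∈S , _)            = p zero , p∈S zero

-- Generators of null weight are replaced by one of positive weight.
Conv-support : ∀ {n m} {T : Point n → Set} {x} (p : Fin m → Point n) (w : Fin m → ℚ) →
               (∀ k → 0ℚ ℚ.≤ w k) → ∑ w ≡ 1ℚ → (∀ t → x t ≡ ∑ (λ k → w k * p k t)) →
               (∀ k → w k ≡ 0ℚ ⊎ T (p k)) → Conv T x
Conv-support {n} {m} {T} p w w≥0 ∑w≡1 x≡ null-or-T =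
  m , (λ k → pick (null-or-T k)) , w , (λ k → pick∈T (null-or-T k)) , w≥0 , ∑w≡1 ,
  λ t → trans (x≡ t) (∑-cong (λ k → sym (pick-term (null-or-T k) t)))
  where
  positive-weight : ∃[ k ] w k ≢ 0ℚ
  positive-weight = ∑≢0⇒term≢0 w (λ ∑w≡0 → ℚ.1≢0 (trans (sym ∑w≡1) ∑w≡0))
  k₀ : Fin m
  k₀ = proj₁ positive-weight
  p₀∈T : T (p k₀)
  p₀∈T = [ (λ w₀≡0 → ⊥-elim (proj₂ positive-weight w₀≡0)) , id ]′ (null-or-T k₀)
  pick : ∀ {k} → w k ≡ 0ℚ ⊎ T (p k) → Point n
  pick     (inj₁ _) = p k₀
  pick {k} (inj₂ _) = p k
  pick∈T : ∀ {k} (h : w k ≡ 0ℚ ⊎ T (p k)) → T (pick h)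
  pick∈T (inj₁ _)   = p₀∈T
  pick∈T (inj₂ pk∈T) = pk∈T
  pick-term : ∀ {k} (h : w k ≡ 0ℚ ⊎ T (p k)) t → w k * pick h t ≡ w k * p k t
  pick-term {k} (inj₁ wk≡0) t rewrite wk≡0 = trans (ℚ.*-zeroˡ (p k₀ t)) (sym (ℚ.*-zeroˡ (p k t)))
  pick-term (inj₂ _)    t = refl

module _ {n} (c : Point n) (β : ℚ) where

  ∑-slack : ∀ {m x} (p : Fin m → Point n) (w : Fin m → ℚ) → ∑ w ≡ 1ℚ →
            (∀ t → x t ≡ ∑ (λ k → w k * p k t)) → ∑ (λ k → w k * (β - c · p k)) ≡ β - c · x
  ∑-slack {x = x} p w ∑w≡1 x≡ = begin
    ∑ (λ k → w k * (β - c · p k))                      ≡⟨ ∑-cong (λ k → distrib (w k) (c · p k)) ⟩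
    ∑ (λ k → β * w k + - (w k * (c · p k)))            ≡⟨ ∑-distrib-+ (λ k → β * w k) _ ⟩
    ∑ (λ k → β * w k) + ∑ (λ k → - (w k * (c · p k)))
      ≡⟨ cong₂ _+_ (sym (*-distribˡ-∑ β w)) (∑-neg (λ k → w k * (c · p k))) ⟩
    β * ∑ w - ∑ (λ k → w k * (c · p k))
      ≡⟨ cong₂ (λ u v → β * u - v) ∑w≡1 (sym (·-combination c x p w x≡)) ⟩
    β * 1ℚ - c · x                                     ≡⟨ cong (_- c · x) (ℚ.*-identityʳ β) ⟩
    β - c · x                                          ∎
    where
    open ≡-Reasoning
    distrib : ∀ u d → u * (β - d) ≡ β * u + - (u * d)
    distrib u d = solve 3 (λ u b d → u :* (b :- d) := b :* u :+ (:- (u :* d))) refl u β d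

  slack-nonNeg : ∀ {m} (p : Fin m → Point n) (w : Fin m → ℚ) → (∀ k → 0ℚ ℚ.≤ w k) →
                 (∀ k → c · p k ℚ.≤ β) → ∀ k → 0ℚ ℚ.≤ w k * (β - c · p k)
  slack-nonNeg p w w≥0 p≤β k = 0≤p*q (w≥0 k) (p≤q⇒0≤q-p (p≤β k))

  Conv-≤ : ∀ {S : Point n → Set} → (∀ y → S y → c · y ℚ.≤ β) → ∀ {x} → Conv S x → c · x ℚ.≤ β
  Conv-≤ S≤β (m , p , w , p∈S , w≥0 , ∑w≡1 , x≡) = 0≤q-p⇒p≤q
    (subst (0ℚ ℚ.≤_) (∑-slack p w ∑w≡1 x≡) (∑-nonNeg (slack-nonNeg p w w≥0 (λ k → S≤β (p k) (p∈S k)))))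

  Conv-≡ : ∀ {S : Point n → Set} → (∀ y → S y → c · y ≡ β) → ∀ {x} → Conv S x → c · x ≡ β
  Conv-≡ S≡β {x} (m , p , w , p∈S , w≥0 , ∑w≡1 , x≡) = sym (p-q≡0⇒p≡q β (c · x) (begin
    β - c · x                      ≡⟨ ∑-slack p w ∑w≡1 x≡ ⟨
    ∑ (λ k → w k * (β - c · p k))  ≡⟨ ∑-cong (λ k → cong (λ v → w k * (β - v)) (S≡β (p k) (p∈S k))) ⟩
    ∑ (λ k → w k * (β - β))        ≡⟨ ∑-cong (λ k → trans (cong (w k *_) (ℚ.+-inverseʳ β)) (ℚ.*-zeroʳ (w k))) ⟩
    ∑ {m} (λ _ → 0ℚ)               ≡⟨ ∑-zero m ⟩
    0ℚ                             ∎))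
    where open ≡-Reasoning

  Conv-face : ∀ {S : Point n → Set} → (∀ y → S y → c · y ℚ.≤ β) →
              ∀ {x} → Conv S x → c · x ≡ β → Conv (λ y → S y × c · y ≡ β) x
  Conv-face {S} S≤β {x} (m , p , w , p∈S , w≥0 , ∑w≡1 , x≡) cx≡β =
    Conv-support {T = λ y → S y × c · y ≡ β} p w w≥0 ∑w≡1 x≡ null-or-tight
    where
    slack≥0 : ∀ k → 0ℚ ℚ.≤ w k * (β - c · p k)
    slack≥0 = slack-nonNeg p w w≥0 (λ k → S≤β (p k) (p∈S k))
    ∑slack≡0 : ∑ (λ k → w k * (β - c · p k)) ≡ 0ℚ
    ∑slack≡0 = trans (∑-slack p w ∑w≡1 x≡) (trans (cong (_-_ β) cx≡β) (ℚ.+-inverseʳ β))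
    null-or-tight : ∀ k → w k ≡ 0ℚ ⊎ (S (p k) × c · p k ≡ β)
    null-or-tight k = Sum.map₂ (λ gap≡0 → p∈S k , sym (p-q≡0⇒p≡q β (c · p k) gap≡0))
      (p*q≡0⇒p≡0∨q≡0 (w k) (β - c · p k) (∑-nonNeg≡0 slack≥0 ∑slack≡0 k))

-- Faces of Q̃_{K_n} and potentials

-- e_i - e_j is the unique maximiser of (e_i - e_j) · y over the edge vectors y.
edge∈Q⇒edge : ∀ {n} {H : Graph n} {i j : Fin n} → i ≢ j → Q H (edge i j) → H i j
edge∈Q⇒edge {n} {H} {i} {j} i≢j edge∈Q = maximiser⇒edge (Conv-nonempty (Conv-face d two bound edge∈Q d·d≡2))
  where
  d : Point n
  d = edge i j
  two : ℚ
  two = 1ℚ + 1ℚ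
  pairing : ∀ a b → d · edge a b ≡ (𝐞 i a - 𝐞 i b) + (𝐞 j b - 𝐞 j a)
  pairing a b = trans (·-edge d a b)
    (solve 4 (λ ia ja ib jb → (ia :- ja) :- (ib :- jb) := (ia :- ib) :+ (jb :- ja)) refl
      (𝐞 i a) (𝐞 j a) (𝐞 i b) (𝐞 j b))
  bound : ∀ y → EdgeVecs H y → d · y ℚ.≤ two
  bound y (a , b , _ , y≗) = ℚ.≤-trans (ℚ.≤-reflexive (trans (·-cong d y≗) (pairing a b)))
    (ℚ.+-mono-≤ (𝐞-difference≤1 i a b) (𝐞-difference≤1 j b a))
  d·d≡2 : d · d ≡ two
  d·d≡2 = trans (pairing i j)
    (cong₂ _+_ (cong₂ _-_ (𝐞-same {i = i} refl) (𝐞-other i≢j))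
               (cong₂ _-_ (𝐞-same {i = j} refl) (𝐞-other (i≢j ∘ sym))))
  maximiser⇒edge : ∃ (λ y → EdgeVecs H y × d · y ≡ two) → H i j
  maximiser⇒edge (y , (a , b , hab , y≗) , d·y≡2) =
    subst₂ H (sym (𝐞-difference≡1 i a b (proj₁ brackets≡1))) (sym (𝐞-difference≡1 j b a (proj₂ brackets≡1))) hab
    where
    brackets≡1 : 𝐞 i a - 𝐞 i b ≡ 1ℚ × 𝐞 j b - 𝐞 j a ≡ 1ℚ
    brackets≡1 = p+q≡2⇒p≡1∧q≡1 (𝐞-difference≤1 i a b) (𝐞-difference≤1 j b a)
      (trans (sym (trans (·-cong d y≗) (pairing a b))) d·y≡2)

origin∉Q : ∀ {n} {H : Graph n} → SubgraphOfK H → ¬ Q H 𝟎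
origin∉Q {n} {H} H⊆K 𝟎∈Q = null-edge-absurd (Conv-nonempty (Conv-face φ 0ℚ bound 𝟎∈Q (·-𝟎 φ)))
  where
  φ : Point n
  φ t = ι (toℕ t)
  bound : ∀ y → EdgeVecs H y → φ · y ℚ.≤ 0ℚ
  bound y (a , b , hab , y≗) = ℚ.≤-trans (ℚ.≤-reflexive (·-≗edge φ {i = a} {b} y≗))
    (p≤r+q⇒p-q≤r (ℚ.≤-trans (ι-mono-≤ (ℕ.<⇒≤ (H⊆K a b hab))) (ℚ.≤-reflexive (sym (ℚ.+-identityˡ (φ b))))))
  null-edge-absurd : ¬ ∃ (λ y → EdgeVecs H y × φ · y ≡ 0ℚ)
  null-edge-absurd (y , (a , b , hab , y≗) , φ·y≡0) =
    ℕ.<-irrefl (ι-injective (p-q≡0⇒p≡q (φ a) (φ b) (trans (sym (·-≗edge φ {i = a} {b} y≗)) φ·y≡0))) (H⊆K a b hab)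

record Potential {n} (H : Graph n) : Set where
  field
    c     : Point n
    β     : ℚ
    β>0   : 0ℚ ℚ.< β
    valid : ∀ i j → i Fin.< j → c i - c j ℚ.≤ β
    tight : ∀ i j → H i j ⇔ (i Fin.< j × c i - c j ≡ β)

Q̃-generator : ∀ {n} → Graph n → Point n → Set
Q̃-generator G x = (∀ t → x t ≡ 0ℚ) ⊎ EdgeVecs G x

potential⇒face : ∀ {n} {H : Graph n} → Potential H → IsFace (Q H) (Q̃ (K n))
potential⇒face {n} {H} P = c , β , (λ _ → Conv-≤ c β generator≤β) , λ _ → mk⇔ Q⇒face face⇒Q
  where
  open Potential P
  generator≤β : ∀ y → Q̃-generator (K n) y → c · y ℚ.≤ β
  generator≤β y (inj₁ y≗𝟎)              = ℚ.≤-trans (ℚ.≤-reflexive (·-≗𝟎 c y≗𝟎)) (ℚ.<⇒≤ β>0)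
  generator≤β y (inj₂ (i , j , i<j , y≗)) = ℚ.≤-trans (ℚ.≤-reflexive (·-≗edge c y≗)) (valid i j i<j)
  Q⇒face : ∀ {x} → Q H x → Q̃ (K n) x × c · x ≡ β
  Q⇒face x∈Q =
    Conv-mono {S = EdgeVecs H} {T = Q̃-generator (K n)}
      (λ y (i , j , hij , y≗) → inj₂ (i , j , proj₁ (to (tight i j) hij) , y≗)) x∈Q ,
    Conv-≡ c β {S = EdgeVecs H} (λ y (i , j , hij , y≗) → trans (·-≗edge c y≗) (proj₂ (to (tight i j) hij))) x∈Q
  face⇒Q : ∀ {x} → Q̃ (K n) x × c · x ≡ β → Q H x
  face⇒Q (x∈Q̃ , cx≡β) = Conv-mono tight-generator (Conv-face c β generator≤β x∈Q̃ cx≡β)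
    where
    tight-generator : ∀ y → Q̃-generator (K n) y × c · y ≡ β → EdgeVecs H y
    tight-generator y (inj₁ y≗𝟎 , cy≡β) = ⊥-elim (ℚ.<-irrefl (trans (sym (·-≗𝟎 c y≗𝟎)) cy≡β) β>0)
    tight-generator y (inj₂ (i , j , i<j , y≗) , cy≡β) =
      i , j , from (tight i j) (i<j , trans (sym (·-≗edge c y≗)) cy≡β) , y≗

face⇒potential : ∀ {n} {H : Graph n} → SubgraphOfK H → IsFace (Q H) (Q̃ (K n)) → Potential H
face⇒potential {n} {H} H⊆K (c , β , Q̃≤β , face⇔) =
  record { c = c ; β = β ; β>0 = β>0 ; valid = valid ; tight = tight }
  where
  edge∈Q̃ : ∀ {i j} → i Fin.< j → Q̃ (K n) (edge i j)
  edge∈Q̃ {i} {j} i<j = Conv-singleton {S = Q̃-generator (K n)} (inj₂ (i , j , i<j , λ _ → refl))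
  𝟎∈Q̃ : Q̃ (K n) 𝟎
  𝟎∈Q̃ = Conv-singleton {S = Q̃-generator (K n)} (inj₁ (λ _ → refl))
  valid : ∀ i j → i Fin.< j → c i - c j ℚ.≤ β
  valid i j i<j = subst (ℚ._≤ β) (·-edge c i j) (Q̃≤β _ (edge∈Q̃ i<j))
  β>0 : 0ℚ ℚ.< β
  β>0 with ℚ.<-cmp 0ℚ β
  ... | tri< 0<β _ _ = 0<β
  ... | tri≈ _ 0≡β _ = ⊥-elim (origin∉Q H⊆K (from (face⇔ 𝟎) (𝟎∈Q̃ , trans (·-𝟎 c) 0≡β)))
  ... | tri> _ _ β<0 = ⊥-elim (ℚ.<-irrefl refl (ℚ.<-≤-trans β<0 (subst (ℚ._≤ β) (·-𝟎 c) (Q̃≤β 𝟎 𝟎∈Q̃))))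
  tight : ∀ i j → H i j ⇔ (i Fin.< j × c i - c j ≡ β)
  tight i j = mk⇔
    (λ hij → H⊆K i j hij ,
      trans (sym (·-edge c i j))
            (proj₂ (to (face⇔ (edge i j)) (Conv-singleton {S = EdgeVecs H} (i , j , hij , λ _ → refl)))))
    (λ (i<j , cij≡β) → edge∈Q⇒edge (Fin.<⇒≢ i<j)
      (from (face⇔ (edge i j)) (edge∈Q̃ i<j , trans (·-edge c i j) cij≡β)))

face⇔potential : ∀ {n} {H : Graph n} → SubgraphOfK H → IsFace (Q H) (Q̃ (K n)) ⇔ Potential H
face⇔potential H⊆K = mk⇔ (face⇒potential H⊆K) potential⇒face

NoPath₂ : ∀ {n} → Graph n → Set
NoPath₂ H = ∀ {x v y} → H x v → H v y → ⊥

OverlapClosed : ∀ {n} → Graph n → Set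
OverlapClosed H = ∀ {a y x z} → H a y → H x z → x Fin.< y → a Fin.< z → H a z

module _ {n} {H : Graph n} (P : Potential H) where
  open Potential P

  potential⇒subgraph : SubgraphOfK H
  potential⇒subgraph i j hij = proj₁ (to (tight i j) hij)

  potential⇒decidable : ∀ i j → Dec (H i j)
  potential⇒decidable i j = Dec.map (⇔-sym (tight i j)) (i Fin.<? j ×-dec c i - c j ℚ.≟ β)

  potential⇒noPath₂ : NoPath₂ H
  potential⇒noPath₂ {x} {v} {y} hxv hvy = ℚ.<-irrefl refl (ℚ.<-≤-trans β<β+β β+β≤β)
    where
    β<β+β : β ℚ.< β + β
    β<β+β = ℚ.<-respˡ-≡ (ℚ.+-identityʳ β) (ℚ.+-monoʳ-< β β>0)
    β+β≤β : β + β ℚ.≤ β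
    β+β≤β = ℚ.≤-trans (ℚ.≤-reflexive (begin
      β + β                      ≡⟨ cong₂ _+_ (proj₂ (to (tight x v) hxv)) (proj₂ (to (tight v y) hvy)) ⟨
      (c x - c v) + (c v - c y)  ≡⟨ solve 3 (λ x v y → (x :- v) :+ (v :- y) := x :- y) refl (c x) (c v) (c y) ⟩
      c x - c y                  ∎))
      (valid x y (ℕ.<-trans (proj₁ (to (tight x v) hxv)) (proj₁ (to (tight v y) hvy))))
      where open ≡-Reasoning

  potential⇒overlapClosed : OverlapClosed H
  potential⇒overlapClosed {a} {y} {x} {z} hay hxz x<y a<z =
    from (tight a z) (a<z , ℚ.≤-antisym (valid a z a<z) β≤ca-cz)
    where
    open ℚ.≤-Reasoning
    β≤ca-cz : β ℚ.≤ c a - c z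
    β≤ca-cz = begin
      β                                      ≡⟨ [p+q]-q≡p β β ⟨
      (β + β) - β                            ≤⟨ ℚ.+-monoʳ-≤ (β + β) (ℚ.neg-antimono-≤ (valid x y x<y)) ⟩
      (β + β) - (c x - c y)                  ≡⟨ cong₂ (λ u v → u + v - (c x - c y))
                                                  (proj₂ (to (tight a y) hay)) (proj₂ (to (tight x z) hxz)) ⟨
      (c a - c y) + (c x - c z) - (c x - c y) ≡⟨ solve 4 (λ a y x z → (a :- y) :+ (x :- z) :- (x :- y) := a :- z)
                                                  refl (c a) (c y) (c x) (c z) ⟩
      c a - c z                              ∎

-- Subdivisions of an interval

Increasing : ∀ {ℓ} → (Fin (suc ℓ) → ℕ) → Set
Increasing g = ∀ k → g (inject₁ k) < g (suc k)

InBlock : ∀ {ℓ} → (Fin (suc (suc ℓ)) → ℕ) → Fin (suc ℓ) → ℕ → Set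
InBlock g k a = g (inject₁ k) ≤ a × a < g (suc k)

increasing⇒monotone : ∀ {ℓ} {g : Fin (suc ℓ) → ℕ} → Increasing g → ∀ {i j} → i Fin.≤ j → g i ≤ g j
increasing⇒monotone             inc {zero}  {zero}  _         = ℕ.≤-refl
increasing⇒monotone {suc ℓ} {g} inc {zero}  {suc j} _         =
  ℕ.≤-trans (ℕ.<⇒≤ (inc zero)) (increasing⇒monotone {g = g ∘ suc} (inc ∘ suc) {zero} {j} z≤n)
increasing⇒monotone {suc ℓ} {g} inc {suc i} {suc j} (s≤s i≤j) =
  increasing⇒monotone {g = g ∘ suc} (inc ∘ suc) i≤j

locate : ∀ {ℓ} (g : Fin (suc (suc ℓ)) → ℕ) {a} → g zero ≤ a → a < g (fromℕ (suc ℓ)) → ∃[ k ] InBlock g k a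
locate {zero}  g     g₀≤a a<gₗ = zero , g₀≤a , a<gₗ
locate {suc ℓ} g {a} g₀≤a a<gₗ with a ℕ.<? g (suc zero)
... | yes a<g₁ = zero , g₀≤a , a<g₁
... | no  a≮g₁ with locate (g ∘ suc) (ℕ.≮⇒≥ a≮g₁) a<gₗ
...   | k , a∈k = suc k , a∈k

locate-vertex : ∀ {n ℓ} (g : Fin (suc (suc ℓ)) → ℕ) → g zero ≡ 0 → g (fromℕ (suc ℓ)) ≡ n →
                (a : Fin n) → ∃[ k ] InBlock g k (toℕ a)
locate-vertex g g₀≡0 gₗ≡n a =
  locate g (subst (_≤ toℕ a) (sym g₀≡0) z≤n) (subst (toℕ a <_) (sym gₗ≡n) (Fin.toℕ<n a))

module _ {ℓ} (g : Fin (suc (suc ℓ)) → ℕ) (inc : Increasing g) where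

  suc≤inject₁ : ∀ {k k′ : Fin (suc ℓ)} → k Fin.< k′ → suc k Fin.≤ inject₁ k′
  suc≤inject₁ {k′ = k′} k<k′ = subst (toℕ (suc _) ≤_) (sym (Fin.toℕ-inject₁ k′)) k<k′

  block-order : ∀ {k k′ a b} → InBlock g k a → InBlock g k′ b → k Fin.< k′ → a < b
  block-order (_ , a<g) (g≤b , _) k<k′ =
    ℕ.<-≤-trans a<g (ℕ.≤-trans (increasing⇒monotone {g = g} inc (suc≤inject₁ k<k′)) g≤b)

  block-unique : ∀ {k k′ a} → InBlock g k a → InBlock g k′ a → k ≡ k′
  block-unique {k} {k′} a∈k a∈k′ with Fin.<-cmp k k′
  ... | tri< k<k′ _ _ = ⊥-elim (ℕ.<-irrefl refl (block-order a∈k a∈k′ k<k′))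
  ... | tri≈ _ k≡k′ _ = k≡k′
  ... | tri> _ _ k′<k = ⊥-elim (ℕ.<-irrefl refl (block-order a∈k′ a∈k k′<k))

  no-cut-inside-block : ∀ k j → g (inject₁ k) < g j → g j < g (suc k) → ⊥
  no-cut-inside-block k j gₖ<gⱼ gⱼ<gₖ₊₁ with toℕ j ℕ.≤? toℕ k
  ... | yes j≤k =
    ℕ.<⇒≱ gₖ<gⱼ (increasing⇒monotone {g = g} inc (subst (toℕ j ≤_) (sym (Fin.toℕ-inject₁ k)) j≤k))
  ... | no  j≰k = ℕ.<⇒≱ gⱼ<gₖ₊₁ (increasing⇒monotone {g = g} inc {suc k} {j} (ℕ.≰⇒> j≰k))

  first<suc : ∀ k → g zero < g (suc k)
  first<suc k = ℕ.<-≤-trans (inc zero) (increasing⇒monotone {g = g} inc {suc zero} {suc k} (s≤s z≤n))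

record Subdivision (s m : ℕ) : Set where
  field
    ℓ          : ℕ
    cut        : Fin (suc (suc ℓ)) → ℕ
    cut-first  : cut zero ≡ s
    cut-last   : cut (fromℕ (suc ℓ)) ≡ m
    increasing : Increasing cut

CutsExactly : ∀ {s m} → (ℕ → Set) → Subdivision s m → Set
CutsExactly {s} {m} P S = ∀ p → s < p → p < m → P p ⇔ (∃[ k ] Subdivision.cut S k ≡ p)

trivial-subdivision : ∀ s → Subdivision s (suc s)
trivial-subdivision s = record
  { ℓ = 0 ; cut = cut ; cut-first = refl ; cut-last = refl ; increasing = λ { zero → ℕ.n<1+n s } }
  where
  cut : Fin 2 → ℕ
  cut zero       = s
  cut (suc zero) = suc s

trivial-subdivision-exact : ∀ {P s} → CutsExactly P (trivial-subdivision s)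
trivial-subdivision-exact p s<p p<s+1 = ⊥-elim (ℕ.<⇒≱ s<p (ℕ.s≤s⁻¹ p<s+1))

add-first-cut : ∀ {s m} → Subdivision (suc s) m → Subdivision s m
add-first-cut {s} S = record
  { ℓ = suc ℓ ; cut = cut′ ; cut-first = refl ; cut-last = cut-last ; increasing = increasing′ }
  where
  open Subdivision S
  cut′ : Fin (suc (suc (suc ℓ))) → ℕ
  cut′ zero    = s
  cut′ (suc k) = cut k
  increasing′ : Increasing cut′
  increasing′ zero    = subst (s <_) (sym cut-first) (ℕ.n<1+n s)
  increasing′ (suc k) = increasing k

extend-first-block : ∀ {s m} → Subdivision (suc s) m → Subdivision s m
extend-first-block {s} S = record
  { ℓ = ℓ ; cut = cut′ ; cut-first = refl ; cut-last = cut-last ; increasing = increasing′ }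
  where
  open Subdivision S
  cut′ : Fin (suc (suc ℓ)) → ℕ
  cut′ zero    = s
  cut′ (suc k) = cut (suc k)
  increasing′ : Increasing cut′
  increasing′ zero    = ℕ.<-trans (subst (s <_) (sym cut-first) (ℕ.n<1+n s)) (increasing zero)
  increasing′ (suc k) = increasing (suc k)

module _ {P : ℕ → Set} {s m} {S : Subdivision (suc s) m} (exact : CutsExactly P S) where
  open Subdivision S

  add-first-cut-exact : P (suc s) → CutsExactly P (add-first-cut S)
  add-first-cut-exact P[s+1] p s<p p<m with ℕ.m≤n⇒m<n∨m≡n s<p
  ... | inj₂ refl  = mk⇔ (λ _ → suc zero , cut-first) (λ _ → P[s+1])
  ... | inj₁ s+1<p = mk⇔
    (λ Pp → Σ.map suc id (to (exact p s+1<p p<m) Pp))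
    (λ { (zero , s≡p) → ⊥-elim (ℕ.<-irrefl s≡p s<p) ; (suc k , cutₖ≡p) → from (exact p s+1<p p<m) (k , cutₖ≡p) })

  extend-first-block-exact : ¬ P (suc s) → CutsExactly P (extend-first-block S)
  extend-first-block-exact ¬P[s+1] p s<p p<m with ℕ.m≤n⇒m<n∨m≡n s<p
  ... | inj₂ refl = mk⇔ (λ P[s+1] → ⊥-elim (¬P[s+1] P[s+1]))
    (λ { (zero , s≡s+1) → ⊥-elim (ℕ.<-irrefl s≡s+1 s<p)
       ; (suc k , cut≡s+1) → ⊥-elim (ℕ.<-irrefl (trans cut-first (sym cut≡s+1)) (first<suc cut increasing k)) })
  ... | inj₁ s+1<p = mk⇔
    (λ Pp → Σ.map suc id (not-first (to (exact p s+1<p p<m) Pp)))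
    (λ { (zero , s≡p) → ⊥-elim (ℕ.<-irrefl s≡p s<p) ; (suc k , cutₖ≡p) → from (exact p s+1<p p<m) (suc k , cutₖ≡p) })
    where
    not-first : ∃[ k ] cut k ≡ p → ∃[ k ] cut (suc k) ≡ p
    not-first (zero  , cut₀≡p) = ⊥-elim (ℕ.<-irrefl (trans (sym cut-first) cut₀≡p) s+1<p)
    not-first (suc k , cutₖ≡p) = k , cutₖ≡p

subdivide : ∀ {P : ℕ → Set} → (∀ p → Dec (P p)) → ∀ {s m} → s ℕ.<‴ m → Σ (Subdivision s m) (CutsExactly P)
subdivide P? {s} ℕ.≤‴-refl = trivial-subdivision s , trivial-subdivision-exact
subdivide P? {s} (ℕ.≤‴-step s+1<m) with subdivide P? s+1<m | P? (suc s)
... | S , exact | yes P[s+1] = add-first-cut S , add-first-cut-exact exact P[s+1]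
... | S , exact | no ¬P[s+1] = extend-first-block S , extend-first-block-exact exact ¬P[s+1]

-- Block decompositions

does≡true⇒ : ∀ {A : Set} (A? : Dec A) → does A? ≡ true → A
does≡true⇒ (yes a) _ = a

∈-tabulate-does : ∀ {n} {P : Fin n → Set} (P? : ∀ a → Dec (P a)) {a} → a ∈ tabulate (does ∘ P?) ⇔ P a
∈-tabulate-does P? {a} = mk⇔
  (λ a∈ → does≡true⇒ (P? a) (trans (sym (Vec.lookup∘tabulate (does ∘ P?) a)) (Vec.[]=⇒lookup a∈)))
  (λ Pa → Vec.lookup⇒[]= a _ (trans (Vec.lookup∘tabulate (does ∘ P?) a) (dec-true (P? a) Pa)))

module _ {n} {H : Graph n} (H⊆K : SubgraphOfK H) (H? : ∀ i j → Dec (H i j))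
         (no-path₂ : NoPath₂ H) (overlap-closed : OverlapClosed H) where

  Spanned : ℕ → Set
  Spanned p = ∃[ x ] ∃[ z ] (H x z × toℕ x < p × p ≤ toℕ z)

  spanned? : ∀ p → Dec (Spanned p)
  spanned? p = Fin.any? (λ x → Fin.any? (λ z → H? x z ×-dec toℕ x ℕ.<? p ×-dec p ℕ.≤? toℕ z))

  Tail Head : Fin n → Set
  Tail a = ∃[ y ] H a y
  Head b = ∃[ x ] H x b

  tail? : ∀ a → Dec (Tail a)
  tail? a = Fin.any? (H? a)

  head? : ∀ b → Dec (Head b)
  head? b = Fin.any? (λ x → H? x b)

  module _ (1≤n : 1 ≤ n) where
    private
      subdivision : Σ (Subdivision 0 n) (CutsExactly (¬_ ∘ Spanned))
      subdivision = subdivide (¬? ∘ spanned?) (ℕ.≤⇒≤‴ 1≤n)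
      exact : CutsExactly (¬_ ∘ Spanned) (proj₁ subdivision)
      exact = proj₂ subdivision
    open Subdivision (proj₁ subdivision)

    inBlock? : ∀ k (a : Fin n) → Dec (InBlock cut k (toℕ a))
    inBlock? k a = cut (inject₁ k) ℕ.≤? toℕ a ×-dec toℕ a ℕ.<? cut (suc k)

    edge-stays-in-block : ∀ {a b k} → H a b → InBlock cut k (toℕ a) → toℕ b < cut (suc k)
    edge-stays-in-block {a} {b} {k} hab (_ , a<cut) with toℕ b ℕ.<? cut (suc k)
    ... | yes b<cut = b<cut
    ... | no  b≮cut = ⊥-elim (from (exact (cut (suc k)) (ℕ.≤-<-trans z≤n a<cut) cut<n) (suc k , refl)
                                  (a , b , hab , a<cut , ℕ.≮⇒≥ b≮cut))
      where
      cut<n : cut (suc k) < n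
      cut<n = ℕ.≤-<-trans (ℕ.≮⇒≥ b≮cut) (Fin.toℕ<n b)

    -- Descent on the tails x of b: once x ≤ a, the edges a → y and x → b overlap; otherwise x lies
    -- strictly inside the block, so is no cut, and an edge u → z spanning x overlaps x → b, giving u → b.
    tail-head⇒edge : ∀ {a b k} → Tail a → Head b → a Fin.< b →
                     InBlock cut k (toℕ a) → InBlock cut k (toℕ b) → H a b
    tail-head⇒edge {a} {b} {k} (y , hay) (x₀ , hx₀b) a<b (cut≤a , _) (_ , b<cut) =
      descend x₀ (Fin.<-wellFounded x₀) hx₀b
      where
      descend : ∀ x → Acc Fin._<_ x → H x b → H a b
      descend x (acc smaller) hxb with toℕ x ℕ.≤? toℕ a
      ... | yes x≤a = overlap-closed hay hxb (ℕ.≤-<-trans x≤a (H⊆K a y hay)) a<b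
      ... | no  x≰a with spanned? (toℕ x)
      ...   | yes (u , z , huz , u<x , x≤z) =
        descend u (smaller u<x) (overlap-closed huz hxb x<z (ℕ.<-trans u<x (H⊆K x b hxb)))
        where
        x<z : x Fin.< z
        x<z = ℕ.≤∧≢⇒< x≤z (λ x≡z → no-path₂ (subst (H u) (sym (Fin.toℕ-injective x≡z)) huz) hxb)
      ...   | no  ¬spanned with to (exact (toℕ x) (ℕ.≤-<-trans z≤n (ℕ.≰⇒> x≰a)) (Fin.toℕ<n x)) ¬spanned
      ...     | j , cutⱼ≡x = ⊥-elim (no-cut-inside-block cut increasing k j
                  (subst (cut (inject₁ k) <_) (sym cutⱼ≡x) (ℕ.≤-<-trans cut≤a (ℕ.≰⇒> x≰a)))
                  (subst (_< cut (suc k)) (sym cutⱼ≡x) (ℕ.<-trans (H⊆K x b hxb) b<cut)))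

    tails heads : Fin (suc ℓ) → Subset n
    tails k = tabulate (λ a → does (tail? a ×-dec inBlock? k a))
    heads k = tabulate (λ b → does (head? b ×-dec inBlock? k b))

    ∈tails : ∀ {k a} → a ∈ tails k ⇔ (Tail a × InBlock cut k (toℕ a))
    ∈tails {k} = ∈-tabulate-does (λ a → tail? a ×-dec inBlock? k a)

    ∈heads : ∀ {k b} → b ∈ heads k ⇔ (Head b × InBlock cut k (toℕ b))
    ∈heads {k} = ∈-tabulate-does (λ b → head? b ×-dec inBlock? k b)

    edge⇒blocks : ∀ a b → H a b → ∃[ k ] (a ∈ tails k × b ∈ heads k × a Fin.< b)
    edge⇒blocks a b hab with locate-vertex cut cut-first cut-last a
    ... | k , a∈k@(cut≤a , _) =
      k , from ∈tails ((b , hab) , a∈k) ,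
      from ∈heads ((a , hab) , ℕ.≤-trans cut≤a (ℕ.<⇒≤ (H⊆K a b hab)) , edge-stays-in-block hab a∈k) ,
      H⊆K a b hab

    blocks⇒edge : ∀ a b → ∃[ k ] (a ∈ tails k × b ∈ heads k × a Fin.< b) → H a b
    blocks⇒edge a b (k , a∈tails , b∈heads , a<b) =
      tail-head⇒edge (proj₁ (to ∈tails a∈tails)) (proj₁ (to ∈heads b∈heads)) a<b
                     (proj₂ (to ∈tails a∈tails)) (proj₂ (to ∈heads b∈heads))

    block-decomposition : BlockDecomposition H
    block-decomposition =
      ℓ , cut , cut-first , cut-last , increasing , tails , heads ,
      (λ k a a∈tails a∈heads → no-path₂ (proj₂ (proj₁ (to ∈heads a∈heads))) (proj₂ (proj₁ (to ∈tails a∈tails)))) ,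
      (λ k a a∈tails → proj₂ (to ∈tails a∈tails)) ,
      (λ k b b∈heads → proj₂ (to ∈heads b∈heads)) ,
      λ a b → mk⇔ (edge⇒blocks a b) (blocks⇒edge a b)

potential-from-ℕ : ∀ {n} {H : Graph n} (δ : ℕ) → 0 < δ → (N : Fin n → ℕ) →
                   (∀ a b → a Fin.< b → N a ≤ δ ℕ.+ N b) →
                   (∀ a b → H a b ⇔ (a Fin.< b × N a ≡ δ ℕ.+ N b)) → Potential H
potential-from-ℕ {H = H} δ 0<δ N N-valid N-tight = record
  { c = ι ∘ N ; β = ι δ ; β>0 = ι-mono-< 0<δ ; valid = valid ; tight = tight }
  where
  valid : ∀ a b → a Fin.< b → ι (N a) - ι (N b) ℚ.≤ ι δ
  valid a b a<b = p≤r+q⇒p-q≤r (ℚ.≤-trans (ι-mono-≤ (N-valid a b a<b)) (ℚ.≤-reflexive (ι-homo-+ δ (N b))))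
  tight : ∀ a b → H a b ⇔ (a Fin.< b × ι (N a) - ι (N b) ≡ ι δ)
  tight a b = mk⇔
    (λ hab → Σ.map₂ (λ Na≡ → from p-q≡r⇔p≡r+q (trans (cong ι Na≡) (ι-homo-+ δ (N b)))) (to (N-tight a b) hab))
    (λ (a<b , step) → from (N-tight a b) (a<b , ι-injective (trans (to p-q≡r⇔p≡r+q step) (sym (ι-homo-+ δ (N b))))))

level : ∀ {A B : Set} → Dec A → Dec B → ℕ
level (yes _) _       = 2
level (no _)  (yes _) = 0
level (no _)  (no _)  = 1

level≤2 : ∀ {A B : Set} (A? : Dec A) (B? : Dec B) → level A? B? ≤ 2
level≤2 (yes _) _       = ℕ.≤-refl
level≤2 (no _)  (yes _) = z≤n
level≤2 (no _)  (no _)  = s≤s z≤n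

level-gap : ∀ {A B A′ B′ : Set} (A? : Dec A) (B? : Dec B) (A′? : Dec A′) (B′? : Dec B′) →
            ¬ (A′ × B′) → level A? B? ≡ 2 ℕ.+ level A′? B′? ⇔ (A × B′)
level-gap (yes a) _       (no _)   (yes b′) _      = mk⇔ (λ _ → a , b′) (λ _ → refl)
level-gap (yes _) _       (no _)   (no ¬b′) _      = mk⇔ (λ ()) (λ (_ , b′) → ⊥-elim (¬b′ b′))
level-gap (yes _) _       (yes a′) _        ¬a′b′ = mk⇔ (λ ()) (λ (_ , b′) → ⊥-elim (¬a′b′ (a′ , b′)))
level-gap (no ¬a) (yes _) _        _        _      = mk⇔ (λ ()) (λ (a , _) → ⊥-elim (¬a a))
level-gap (no ¬a) (no _)  _        _        _      = mk⇔ (λ ()) (λ (a , _) → ⊥-elim (¬a a))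

lex-< : ∀ {t t′ g g′} → t ≤ 2 → g < g′ → t ℕ.+ 3 ℕ.* g < t′ ℕ.+ 3 ℕ.* g′
lex-< {t} {t′} {g} {g′} t≤2 g<g′ = begin-strict
  t ℕ.+ 3 ℕ.* g    ≤⟨ ℕ.+-monoˡ-≤ (3 ℕ.* g) t≤2 ⟩
  2 ℕ.+ 3 ℕ.* g    <⟨ ℕ.n<1+n _ ⟩
  3 ℕ.+ 3 ℕ.* g    ≡⟨ ℕ.*-suc 3 g ⟨
  3 ℕ.* suc g      ≤⟨ ℕ.*-monoʳ-≤ 3 g<g′ ⟩
  3 ℕ.* g′         ≤⟨ ℕ.m≤n+m (3 ℕ.* g′) t′ ⟩
  t′ ℕ.+ 3 ℕ.* g′  ∎
  where open ℕ.≤-Reasoning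

module _ {n} {H : Graph n} {ℓ} (ns : Fin (suc (suc ℓ)) → ℕ) (ns-first : ns zero ≡ 0)
         (ns-last : ns (fromℕ (suc ℓ)) ≡ n) (increasing : Increasing ns) (L R : Fin (suc ℓ) → Subset n)
         (disjoint : ∀ k a → a ∈ L k → a ∈ R k → ⊥)
         (L-in-block : ∀ k a → a ∈ L k → InBlock ns k (toℕ a))
         (R-in-block : ∀ k a → a ∈ R k → InBlock ns k (toℕ a))
         (H⇔ : ∀ a b → H a b ⇔ (∃[ k ] (a ∈ L k × b ∈ R k × a Fin.< b))) where

  private
    located : ∀ a → ∃[ k ] InBlock ns k (toℕ a)
    located = locate-vertex ns ns-first ns-last

  block : Fin n → Fin (suc ℓ)
  block a = proj₁ (located a)

  block-of-L : ∀ {k a} → a ∈ L k → block a ≡ k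
  block-of-L {k} {a} a∈L = block-unique ns increasing (proj₂ (located a)) (L-in-block k a a∈L)

  block-of-R : ∀ {k a} → a ∈ R k → block a ≡ k
  block-of-R {k} {a} a∈R = block-unique ns increasing (proj₂ (located a)) (R-in-block k a a∈R)

  block-monotone : ∀ {a b} → a Fin.< b → toℕ (block a) ≤ toℕ (block b)
  block-monotone {a} {b} a<b = ℕ.≮⇒≥ λ blockb<blocka →
    ℕ.<-asym a<b (block-order ns increasing (proj₂ (located b)) (proj₂ (located a)) blockb<blocka)

  edge⇒same-block : ∀ {a b} → H a b → block a ≡ block b
  edge⇒same-block {a} {b} hab with to (H⇔ a b) hab
  ... | k , a∈L , b∈R , _ = trans (block-of-L a∈L) (sym (block-of-R b∈R))

  edge⇔tail-head : ∀ {a b} → a Fin.< b → block a ≡ block b → H a b ⇔ (a ∈ L (block a) × b ∈ R (block b))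
  edge⇔tail-head {a} {b} a<b same = mk⇔
    (λ hab → let k , a∈L , b∈R , _ = to (H⇔ a b) hab in
      subst (λ k → a ∈ L k) (sym (block-of-L a∈L)) a∈L , subst (λ k → b ∈ R k) (sym (block-of-R b∈R)) b∈R)
    (λ (a∈L , b∈R) → from (H⇔ a b) (block a , a∈L , subst (λ k → b ∈ R k) (sym same) b∈R , a<b))

  tier : Fin n → ℕ
  tier a = level (a ∈? L (block a)) (a ∈? R (block a))

  height : Fin n → ℕ
  height a = tier a ℕ.+ 3 ℕ.* toℕ (block a)

  height-step : ∀ {a b} → a Fin.< b → height a ≤ 2 ℕ.+ height b × (height a ≡ 2 ℕ.+ height b ⇔ H a b)
  height-step {a} {b} a<b with ℕ.m≤n⇒m<n∨m≡n (block-monotone a<b)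
  ... | inj₁ block< = ℕ.≤-trans (ℕ.<⇒≤ ha<hb) (ℕ.m≤n+m (height b) 2) ,
    mk⇔ (λ ha≡ → ⊥-elim (ℕ.<-irrefl ha≡ (ℕ.<-≤-trans ha<hb (ℕ.m≤n+m (height b) 2))))
        (λ hab → ⊥-elim (ℕ.<-irrefl (cong toℕ (edge⇒same-block hab)) block<))
    where
    ha<hb : height a < height b
    ha<hb = lex-< {t′ = tier b} (level≤2 (a ∈? L (block a)) (a ∈? R (block a))) block<
  ... | inj₂ block≡ =
    ℕ.≤-trans (ℕ.+-monoˡ-≤ g (ℕ.≤-trans (level≤2 (a ∈? L (block a)) (a ∈? R (block a))) (ℕ.m≤m+n 2 (tier b))))
              (ℕ.≤-reflexive shift) ,
    ⇔-sym (edge⇔tail-head a<b (Fin.toℕ-injective block≡)) ⇔-∘ (tier-gap⇔tail-head ⇔-∘ height-gap⇔tier-gap)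
    where
    g : ℕ
    g = 3 ℕ.* toℕ (block a)
    shift : (2 ℕ.+ tier b) ℕ.+ g ≡ 2 ℕ.+ height b
    shift = trans (ℕ.+-assoc 2 (tier b) g) (cong (λ x → 2 ℕ.+ (tier b ℕ.+ 3 ℕ.* x)) block≡)
    height-gap⇔tier-gap : height a ≡ 2 ℕ.+ height b ⇔ tier a ≡ 2 ℕ.+ tier b
    height-gap⇔tier-gap = mk⇔ (λ ha≡ → ℕ.+-cancelʳ-≡ g _ _ (trans ha≡ (sym shift)))
                              (λ ta≡ → trans (cong (ℕ._+ g) ta≡) shift)
    tier-gap⇔tail-head : tier a ≡ 2 ℕ.+ tier b ⇔ (a ∈ L (block a) × b ∈ R (block b))
    tier-gap⇔tail-head = level-gap (a ∈? L (block a)) (a ∈? R (block a)) (b ∈? L (block b)) (b ∈? R (block b))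
                                   (λ (b∈L , b∈R) → disjoint (block b) b b∈L b∈R)

  decomposition⇒potential : Potential H
  decomposition⇒potential = potential-from-ℕ 2 (s≤s z≤n) height
    (λ a b a<b → proj₁ (height-step a<b))
    (λ a b → mk⇔ (λ hab → H⊆K hab , from (proj₂ (height-step (H⊆K hab))) hab)
                 (λ (a<b , step) → to (proj₂ (height-step a<b)) step))
    where
    H⊆K : ∀ {a b} → H a b → a Fin.< b
    H⊆K {a} {b} hab = let _ , _ , _ , a<b = to (H⇔ a b) hab in a<b

potential⇔decomposition : ∀ {n} {H : Graph n} → 1 ≤ n → Potential H ⇔ BlockDecomposition H
potential⇔decomposition {H = H} 1≤n = mk⇔
  (λ P → block-decomposition (potential⇒subgraph P) (potential⇒decidable P)
                             (potential⇒noPath₂ P) (potential⇒overlapClosed P) 1≤n)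
  (λ (ℓ , ns , ns-first , ns-last , increasing , L , R , disjoint , L-in-block , R-in-block , H⇔) →
    decomposition⇒potential {H = H} ns ns-first ns-last increasing L R disjoint L-in-block R-in-block H⇔)

corollary5p10 : (n : ℕ) → 1 ≤ n → (H : Graph n) → SubgraphOfK H →
    IsFace (Q H) (Q̃ (K n)) ⇔ BlockDecomposition H
corollary5p10 n 1≤n H H⊆K = potential⇔decomposition 1≤n ⇔-∘ face⇔potential H⊆K
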